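{- Let $A$ be a set and $s\colon M(A)\to L(A)$ a section of $q$ satisfying is-head-least and is-tail-sort, and let $\le_s$ be the relation derived from $s$. Then for all $xs:M(A)$, $\mathrm{isSorted}_{\le_s}(s(xs))$ holds. Equivalently, for all lists $xs:L(A)$, $xs\in\mathrm{im}(s)$ if and only if $\mathrm{isSorted}_{\le_s}(xs)$.
   Context: Univalent type theory. $L(A)$ is the free monoid on $A$ (finite lists, $x::xs$ prepending), $M(A)$ the free commutative monoid (finite multisets) with generators $\eta_A$, $\langle x,y\rangle=\eta_A(x)\cdot\eta_A(y)$, $q$ the monoid homomorphism $L(A)\to M(A)$ extending $\eta_A$; a section is $s$ with $q\circ s=\mathrm{id}$. $\mathrm{head}\colon L(A)\to1+A$ returns $\mathrm{inl}(\ast)$ on $[]$ and $\mathrm{inr}(x)$ on $x::xs$; $x\le_s y$ means $\mathrm{head}(s(\langle x,y\rangle))=\mathrm{inr}(x)$. $xs\in\mathrm{im}(s)$ means there merely exists $ys$ with $s(ys)=xs$; $y\in xs$ means $y$ equals some entry of $xs$. is-head-least: for all $x,y,xs$, $y\in x::xs$ and $x::xs\in\mathrm{im}(s)$ imply $[x,y]\in\mathrm{im}(s)$. is-tail-sort: for all $x,xs$, $x::xs\in\mathrm{im}(s)$ implies $xs\in\mathrm{im}(s)$. For a relation $\le$, $\mathrm{isSorted}_\le$ is the inductive predicate on lists generated by: $[]$ is sorted; $[x]$ is sorted; if $x\le y$ and $y::zs$ is sorted then $x::y::zs$ is sorted. -}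

module Defs where

open import Data.List using (List; []; _∷_; [_])
open import Data.Maybe using (Maybe; just; nothing)
open import Data.Product using (Σ; _×_)
open import Relation.Binary.PropositionalEquality using (_≡_)
open import Data.List.Membership.Propositional using (_∈_)
open import Data.List.Relation.Binary.Permutation.Propositional using (_↭_)

-- M(A), the free commutative monoid on A, is modelled as the setoid
-- (List A, _↭_) (lists modulo permutation); q : L(A) → M(A) is then the
-- identity on underlying lists, and ⟨x,y⟩ = η x · η y is the list x ∷ y ∷ [].

record Section (A : Set) : Set where
  field
    s         : List A → List A
    s-resp    : ∀ {xs ys} → xs ↭ ys → s xs ≡ s ys
    s-section : ∀ xs → s xs ↭ xs
open Section public

head : {A : Set} → List A → Maybe A
head []       = nothing
head (x ∷ _)  = just x

⟨_,_⟩ : {A : Set} → A → A → List A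
⟨ x , y ⟩ = x ∷ y ∷ []

_≤[_]_ : {A : Set} → A → Section A → A → Set
x ≤[ σ ] y = head (s σ ⟨ x , y ⟩) ≡ just x

InIm : {A : Set} → Section A → List A → Set
InIm {A} σ xs = Σ (List A) (λ ys → s σ ys ≡ xs)

is-head-least : {A : Set} → Section A → Set
is-head-least {A} σ = ∀ (x y : A) (xs : List A) →
  y ∈ (x ∷ xs) → InIm σ (x ∷ xs) → InIm σ (x ∷ y ∷ [])

is-tail-sort : {A : Set} → Section A → Set
is-tail-sort {A} σ = ∀ (x : A) (xs : List A) → InIm σ (x ∷ xs) → InIm σ xs

data IsSorted {A : Set} (_≤_ : A → A → Set) : List A → Set where
  sorted-[]  : IsSorted _≤_ []
  sorted-[-] : ∀ x → IsSorted _≤_ [ x ]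
  sorted-∷   : ∀ {x y zs} → x ≤ y → IsSorted _≤_ (y ∷ zs) → IsSorted _≤_ (x ∷ y ∷ zs)

IsSet : Set → Set
IsSet A = ∀ {x y : A} (p q : x ≡ y) → p ≡ q

-- The derived relation ≤ₛ is reflexive and antisymmetric for any section, since
-- s ⟨x,y⟩ = s ⟨y,x⟩ is a permutation of [x,y]. Head-leastness says the head of a
-- list in the image is ≤ₛ-below all its entries; applied to s [x,y,z] it gives
-- transitivity. With tail-sortness, induction on the list shows that the image
-- is exactly the sorted lists: a list in the image has its head below its second
-- entry and a tail in the image; conversely, if x is least in x ∷ t and t is in
-- the image, then s (x ∷ t) has head x and a tail in the image permuting t, and
-- two permuted lists in the image coincide since s is constant on permutations.
module Submission where

open import Defs
open import Data.List using (List; []; _∷_)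
open import Data.Maybe.Properties using (just-injective)
open import Data.Product using (_×_; _,_; ∃₂)
open import Data.Empty using (⊥-elim)
open import Function.Bundles using (_⇔_; mk⇔)
open import Relation.Binary.Definitions using (Reflexive; Transitive)
open import Relation.Binary.PropositionalEquality
open import Data.List.Membership.Propositional using (_∈_)
open import Data.List.Relation.Unary.Any using (here; there)
open import Data.List.Relation.Binary.Permutation.Propositional using (_↭_; ↭-sym; ↭-refl; swap)
open import Data.List.Relation.Binary.Permutation.Propositional.Properties
  using (↭-empty-inv; ¬x∷xs↭[]; ∈-resp-↭; drop-∷)

module _ {A : Set} {_≤_ : A → A → Set} (≤-refl : Reflexive _≤_) (≤-trans : Transitive _≤_) where

  sorted-head-≤ : ∀ {x t w} → IsSorted _≤_ (x ∷ t) → w ∈ x ∷ t → x ≤ w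
  sorted-head-≤ (sorted-[-] _)  (here refl) = ≤-refl
  sorted-head-≤ (sorted-∷ _ _)  (here refl) = ≤-refl
  sorted-head-≤ (sorted-∷ p so) (there w∈) = ≤-trans p (sorted-head-≤ so w∈)

module _ {A : Set} (σ : Section A) where

  _≤_ : A → A → Set
  x ≤ y = x ≤[ σ ] y

  image-fixed : ∀ {l} → InIm σ l → s σ l ≡ l
  image-fixed (ys , refl) = s-resp σ (s-section σ ys)

  image-↭⇒≡ : ∀ {l l′} → InIm σ l → InIm σ l′ → l ↭ l′ → l ≡ l′
  image-↭⇒≡ {l} {l′} im im′ l↭l′ = begin
    l        ≡⟨ image-fixed im ⟨
    s σ l    ≡⟨ s-resp σ l↭l′ ⟩
    s σ l′   ≡⟨ image-fixed im′ ⟩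
    l′       ∎
    where open ≡-Reasoning

  []-image : InIm σ []
  []-image = [] , ↭-empty-inv (s-section σ [])

  s-∷-view : ∀ x t → ∃₂ λ h r → s σ (x ∷ t) ≡ h ∷ r × h ∷ r ↭ x ∷ t
  s-∷-view x t with s σ (x ∷ t) | s-section σ (x ∷ t)
  ... | []    | P = ⊥-elim (¬x∷xs↭[] (↭-sym P))
  ... | h ∷ r | P = h , r , refl , P

  ≤-refl : ∀ {x} → x ≤ x
  ≤-refl {x} with s-∷-view x (x ∷ [])
  ... | h , r , eq , P with ∈-resp-↭ P (here refl)
  ... | here refl         = cong head eq
  ... | there (here refl) = cong head eq

  ≤-antisym : ∀ {x y} → x ≤ y → y ≤ x → x ≡ y
  ≤-antisym {x} {y} x≤y y≤x =
    just-injective (trans (sym x≤y) (trans (cong head (s-resp σ (swap x y ↭-refl))) y≤x))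

  module _ (head-least : is-head-least σ) (tail-sort : is-tail-sort σ) where

    image-head-≤ : ∀ {h r y} → InIm σ (h ∷ r) → y ∈ h ∷ r → h ≤ y
    image-head-≤ {h} {r} {y} im y∈ = cong head (image-fixed (head-least h y r y∈ im))

    ≤-trans : ∀ {x y z} → x ≤ y → y ≤ z → x ≤ z
    ≤-trans {x} {y} {z} x≤y y≤z with s-∷-view x (y ∷ z ∷ [])
    ... | h , r , eq , P with ∈-resp-↭ P (here refl)
    ... | here refl =
      image-head-≤ (_ , eq) (∈-resp-↭ (↭-sym P) (there (there (here refl))))
    ... | there (here refl) =
      subst (_≤ z) (sym (≤-antisym x≤y (image-head-≤ (_ , eq) (∈-resp-↭ (↭-sym P) (here refl))))) y≤z
    ... | there (there (here refl)) =
      subst (x ≤_) (≤-antisym y≤z (image-head-≤ (_ , eq) (∈-resp-↭ (↭-sym P) (there (here refl))))) x≤y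

    image⇒sorted : ∀ l → InIm σ l → IsSorted _≤_ l
    image⇒sorted []           _  = sorted-[]
    image⇒sorted (x ∷ [])     _  = sorted-[-] x
    image⇒sorted (x ∷ y ∷ zs) im =
      sorted-∷ (image-head-≤ im (there (here refl))) (image⇒sorted (y ∷ zs) (tail-sort x (y ∷ zs) im))

    least-∷-image : ∀ {x t} → (∀ {w} → w ∈ x ∷ t → x ≤ w) → InIm σ t → InIm σ (x ∷ t)
    least-∷-image {x} {t} x-least t-im with s-∷-view x t
    ... | h , r , eq , P = x ∷ t , trans eq (cong₂ _∷_ h≡x r≡t)
      where
      im : InIm σ (h ∷ r)
      im = x ∷ t , eq
      h≡x : h ≡ x
      h≡x = ≤-antisym (image-head-≤ im (∈-resp-↭ (↭-sym P) (here refl))) (x-least (∈-resp-↭ P (here refl)))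
      r≡t : r ≡ t
      r≡t = image-↭⇒≡ (tail-sort h r im) t-im (drop-∷ (subst (λ z → z ∷ r ↭ x ∷ t) h≡x P))

    sorted⇒image : ∀ {l} → IsSorted _≤_ l → InIm σ l
    sorted⇒image sorted-[]        = []-image
    sorted⇒image (sorted-[-] x)   = least-∷-image (sorted-head-≤ ≤-refl ≤-trans (sorted-[-] x)) []-image
    sorted⇒image so@(sorted-∷ _ tail-sorted) =
      least-∷-image (sorted-head-≤ ≤-refl ≤-trans so) (sorted⇒image tail-sorted)

proposition68 : (A : Set) → IsSet A → (σ : Section A) →
    is-head-least σ → is-tail-sort σ →
    ((xs : List A) → IsSorted (λ x y → x ≤[ σ ] y) (s σ xs))
    × ((xs : List A) → InIm σ xs ⇔ IsSorted (λ x y → x ≤[ σ ] y) xs)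
proposition68 A _ σ head-least tail-sort =
  (λ xs → image⇒sorted σ head-least tail-sort (s σ xs) (xs , refl)) ,
  (λ xs → mk⇔ (image⇒sorted σ head-least tail-sort xs) (sorted⇒image σ head-least tail-sort))
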